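{- Let $0<\alpha<1$ be real and $k\ge 1$ an integer. Then every $n\in B_{(k+1)\alpha}$ can be most-efficiently represented in at least one of the following forms: (1) If $k=1$: there is a good factorization $n=u\cdot v$ with $u,v\in B_\alpha$, or a good factorization $n=u\cdot v\cdot w$ with $u,v,w\in B_\alpha$. If $k\ge2$: there is a good factorization $n=u\cdot v$ with $u\in B_{i\alpha}$, $v\in B_{j\alpha}$, where $i+j=k+2$ and $2\le i,j\le k$. (2) $n=a+b$ with $\|n\|=\|a\|+\|b\|$, where $a\in A_{k\alpha}$, $b\le a$ is a solid number, and $\delta(a)+\|b\|<(k+1)\alpha+3\log_3 2$. (3) There is a good factorization $n=(a+b)\cdot v$ with $v\in B_\alpha$, where $\|a+b\|=\|a\|+\|b\|$, $a\in A_{k\alpha}$, $b\le a$ is a solid number, and $\delta(a)+\|b\|<(k+1)\alpha+3\log_3 2$. (4) $n\in T_\alpha$ (and thus in particular either $n=1$ or $\|n\|=\|n-1\|+1$). (5) There is a good factorization $n=u\cdot v$ with $u\in T_\alpha$ and $v\in B_\alpha$.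
   Context: For a positive integer $n$, its complexity $\|n\|$ is the least number of $1$'s needed to write $n$ using only the constant $1$, addition, multiplication, and parentheses (so $\|1\|=1$ and for $n>1$, $\|n\|=\min\{\|a\|+\|b\|: a,b<n,\ a+b=n \text{ or } ab=n\}$). The defect is $\delta(n)=\|n\|-3\log_3 n$. A positive integer $n$ is a leader if it is not the case that $3\mid n$ and $\|n\|=3+\|n/3\|$. For real $r\ge0$, $A_r=\{n\in\mathbb{N}:\delta(n)<r\}$ and $B_r$ is the set of elements of $A_r$ that are leaders. A factorization $n=u_1\cdots u_k$ into positive integers is a good factorization if $\|n\|=\|u_1\|+\cdots+\|u_k\|$; a positive integer is multiplicatively irreducible if it has no good factorization with at least two factors. A positive integer $n$ is solid if there are no positive integers $u,v$ with $n=u+v$ and $\|n\|=\|u\|+\|v\|$. For $\alpha>0$, $T_\alpha$ is the set consisting of $1$ together with all multiplicatively irreducible $n$ which satisfy $\frac{1}{n-1}>3^{\frac{1-\alpha}{3}}-1$ and for which there is no solid number $b$ with $1<b\le n/2$ and $\|n\|=\|n-b\|+\|b\|$. "Most-efficiently represented" means the displayed decomposition achieves the complexity of $n$, i.e., the complexities of the pieces add up to $\|n\|$. -}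

module Defs where

open import Data.Nat using (ℕ; zero; suc; _+_; _*_; _∸_; _^_; _≤_; _<_; _⊓_)
open import Data.Nat.Divisibility using (_∣_)
open import Data.Nat.DivMod using (_/_)
open import Data.Nat.Base using (_≡ᵇ_)
open import Data.Bool using (Bool; true; false; _∨_; if_then_else_)
open import Data.List using (List; []; _∷_; foldr; upTo; map; concatMap; length)
open import Data.Nat.ListAction using (sum; product)
open import Data.List.Relation.Unary.All using (All)
open import Data.Integer using (+_)
open import Data.Rational using (ℚ) renaming (_/_ to _/ℚ_; _<_ to _<ℚ_)
open import Data.Product using (Σ; ∃; ∃-syntax; _×_; _,_)
open import Data.Sum using (_⊎_)
open import Data.Empty using (⊥)
open import Relation.Nullary using (¬_)
open import Relation.Binary.PropositionalEquality using (_≡_)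

-- Integer complexity, computed by the recursive definition
--   ‖1‖ = 1,  ‖n‖ = min { ‖a‖+‖b‖ : a,b < n, a+b = n or a*b = n }  (n > 1)
-- using fuel (fuel n suffices for argument n).  ‖0‖ is junk (= 0);
-- it is never used: all arguments below are positive.

private
  pairs : ℕ → List (ℕ × ℕ)
  pairs n = concatMap (λ a → concatMap (λ b →
              if ((a + b) ≡ᵇ n) ∨ ((a * b) ≡ᵇ n) then (a , b) ∷ [] else [])
              (map suc (upTo (n ∸ 1)))) (map suc (upTo (n ∸ 1)))

cx : ℕ → ℕ → ℕ
cx zero n = 0
cx (suc f) zero = 0
cx (suc f) (suc zero) = 1
cx (suc f) (suc (suc m)) =
  foldr (λ p r → (cx f (Data.Product.proj₁ p) + cx f (Data.Product.proj₂ p)) ⊓ r)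
        (cx f 1 + cx f (suc m))
        (pairs (suc (suc m)))

‖_‖ : ℕ → ℕ
‖ n ‖ = cx n n

record ℝ : Set₁ where
  field
    L U         : ℚ → Set
    L-inhabited : ∃[ q ] L q
    U-inhabited : ∃[ q ] U q
    L-lower     : ∀ {p q} → p <ℚ q → L q → L p
    U-upper     : ∀ {p q} → p <ℚ q → U p → U q
    L-rounded   : ∀ {p} → L p → ∃[ q ] (p <ℚ q × L q)
    U-rounded   : ∀ {q} → U q → ∃[ p ] (p <ℚ q × U p)
    disjoint    : ∀ {q} → L q → U q → ⊥
    located     : ∀ {p q} → p <ℚ q → L p ⊎ U q

open ℝ public

-- For α > 0 and naturals N, D (D > 0, m ≥ 1):
--   Below α m N D   ⇔   N / D < 3^(m·α)
-- witnessed by a rational s = p/(q+1) with 0 ≤ s < α and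
-- N^(q+1) < D^(q+1) · 3^(m·p), i.e. N/D < 3^(m·s).
Below : ℝ → ℕ → ℕ → ℕ → Set
Below α m N D = ∃[ p ] ∃[ q ]
  (L α ((+ p) /ℚ suc q) × N ^ suc q < D ^ suc q * 3 ^ (m * p))

-- n ∈ A_{m·α}  ⇔  δ(n) < m·α  ⇔  3^‖n‖ / n^3 < 3^(m·α)
InA : ℝ → ℕ → ℕ → Set
InA α m n = 1 ≤ n × Below α m (3 ^ ‖ n ‖) (n ^ 3)

Leader : ℕ → Set
Leader n = ¬ (3 ∣ n × ‖ n ‖ ≡ 3 + ‖ n / 3 ‖)

InB : ℝ → ℕ → ℕ → Set
InB α m n = InA α m n × Leader n

GoodFact : ℕ → List ℕ → Set
GoodFact n us = All (1 ≤_) us × product us ≡ n × ‖ n ‖ ≡ sum (map ‖_‖ us)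

MultIrred : ℕ → Set
MultIrred n = ∀ us → 2 ≤ length us → ¬ GoodFact n us

Solid : ℕ → Set
Solid n = ¬ (∃[ u ] ∃[ v ] (1 ≤ u × 1 ≤ v × u + v ≡ n × ‖ n ‖ ≡ ‖ u ‖ + ‖ v ‖))

-- δ(a) + ‖b‖ < m·α + 3 log₃ 2  ⇔  3^(‖a‖+‖b‖) / (8 a^3) < 3^(m·α)
SumBound : ℝ → ℕ → ℕ → ℕ → Set
SumBound α m a b = Below α m (3 ^ (‖ a ‖ + ‖ b ‖)) (8 * a ^ 3)

-- n ∈ T_α.  For n ≥ 2:  1/(n-1) > 3^((1-α)/3) - 1  ⇔  3 (n-1)^3 / n^3 < 3^α
InT : ℝ → ℕ → Set
InT α n = n ≡ 1 ⊎
  (2 ≤ n × MultIrred n × Below α 1 (3 * (n ∸ 1) ^ 3) (n ^ 3) ×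
   ¬ (∃[ b ] (Solid b × 1 < b × 2 * b ≤ n × ‖ n ‖ ≡ ‖ n ∸ b ‖ + ‖ b ‖)))

Form1 : ℝ → ℕ → ℕ → Set
Form1 α k n =
  (k ≡ 1 ×
    ((∃[ u ] ∃[ v ] (GoodFact n (u ∷ v ∷ []) × InB α 1 u × InB α 1 v)) ⊎
     (∃[ u ] ∃[ v ] ∃[ w ] (GoodFact n (u ∷ v ∷ w ∷ []) ×
                            InB α 1 u × InB α 1 v × InB α 1 w))))
  ⊎
  (2 ≤ k ×
    ∃[ i ] ∃[ j ] ∃[ u ] ∃[ v ]
      (i + j ≡ k + 2 × 2 ≤ i × i ≤ k × 2 ≤ j × j ≤ k ×
       GoodFact n (u ∷ v ∷ []) × InB α i u × InB α j v))

Form2 : ℝ → ℕ → ℕ → Set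
Form2 α k n = ∃[ a ] ∃[ b ]
  (1 ≤ b × a + b ≡ n × ‖ n ‖ ≡ ‖ a ‖ + ‖ b ‖ ×
   InA α k a × b ≤ a × Solid b × SumBound α (suc k) a b)

Form3 : ℝ → ℕ → ℕ → Set
Form3 α k n = ∃[ a ] ∃[ b ] ∃[ v ]
  (1 ≤ b × GoodFact n ((a + b) ∷ v ∷ []) × InB α 1 v ×
   ‖ a + b ‖ ≡ ‖ a ‖ + ‖ b ‖ ×
   InA α k a × b ≤ a × Solid b × SumBound α (suc k) a b)

Form5 : ℝ → ℕ → Set
Form5 α n = ∃[ u ] ∃[ v ] (GoodFact n (u ∷ v ∷ []) × InT α u × InB α 1 v)

module Submission where

-- Write n as a good product of multiplicatively irreducible factors. Defects add along good
-- factorizations, so merging the factors from the left while the merged prefix g keeps δ(g) < kα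
-- stops in one of three ways: a factor of defect ≥ α appears, the factors run out, or the merge
-- overflows. In the last two cases prefix, next factor and rest give form (1), for k ≥ 2 after
-- choosing the least level i ≥ 2 with δ(g) < iα. A factor f of defect ≥ α leaves a cofactor of
-- defect < kα; if the cofactor even has defect < α, the irreducible f is analysed like an
-- irreducible n. Its optimal decomposition is a sum, refined until the smaller summand is solid:
-- either a solid b ≥ 2 with 2b ≤ f splits f optimally, and then δ(f − b) ≤ δ(f) − α, or
-- ‖f‖ = ‖f − 1‖ + 1 and f lies in T_α unless δ(f − 1) ≤ δ(f) − α. This gives forms (2)–(5).
-- The real α enters only through a rational p/(q+1) < α witnessing n ∈ B_{(k+1)α}; raising 3^δ
-- to the power q + 1 turns every defect comparison into an integer inequality.

open import Defs
open import Data.Nat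
open import Data.Nat.Properties
open import Data.Bool using (Bool; true; _∨_; if_then_else_; T)
open import Data.Bool.Properties using (T-∨)
open import Function using (Equivalence)
open import Data.List using (List; []; _∷_; foldr; upTo; map; concatMap; _++_)
open import Data.Nat.ListAction using (sum; product)
open import Data.Nat.ListAction.Properties using (sum-++; product-++)
open import Data.List.Properties using (foldr-map; map-cong-local; foldr-forcesᵇ; map-++)
open import Data.List.Relation.Unary.All.Properties using (++⁺)
open import Data.List.Membership.Propositional using (_∈_; find)
open import Data.List.Membership.Propositional.Properties
  using (∈-map⁺; ∈-map⁻; ∈-upTo⁺; ∈-upTo⁻; ∈-concatMap⁺; ∈-concatMap⁻; foldr-selective)
open import Data.List.Relation.Unary.Any using (here)
import Data.List.Relation.Unary.Any as Any
open import Data.List.Relation.Unary.All as All using (All; []; _∷_)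
open import Data.Product using (∃; ∃-syntax; _×_; _,_; proj₁; proj₂)
open import Data.Empty using (⊥-elim)
import Data.Integer as ℤ
import Data.Integer.Properties as ℤ
open import Data.Rational using (0ℚ; 1ℚ) renaming (_/_ to _/ℚ_; _<_ to _<ℚ_)
open import Data.Rational.Properties using (toℚᵘ-cancel-<; toℚᵘ-fromℚᵘ)
open import Data.Rational.Unnormalised using (mkℚᵘ; *<*)
import Data.Rational.Unnormalised.Properties as ℚᵘ
open import Data.Nat.Divisibility using (divides)
open import Data.Nat.DivMod using (_/_; m*n/n≡m)
open import Data.Nat.Induction using (<-rec)
open import Data.Nat.Tactic.RingSolver using (solve-∀)
open import Data.Sum using (_⊎_; inj₁; inj₂; [_,_]′)
open import Relation.Nullary using (¬_; Dec; yes; no)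
open import Relation.Nullary.Decidable using (map′; _×-dec_; ¬?)
open import Relation.Binary.PropositionalEquality

-- Complexity

-- Defs keeps its list of splittings private; these definitions unfold to the same terms.
isSplitting : ℕ → ℕ → ℕ → Bool
isSplitting n a b = ((a + b) ≡ᵇ n) ∨ ((a * b) ≡ᵇ n)

positivesBelow : ℕ → List ℕ
positivesBelow n = map suc (upTo (n ∸ 1))

splittingIf : ℕ → ℕ → ℕ → List (ℕ × ℕ)
splittingIf n a b = if isSplitting n a b then (a , b) ∷ [] else []

splittings : ℕ → List (ℕ × ℕ)
splittings n = concatMap (λ a → concatMap (splittingIf n a) (positivesBelow n)) (positivesBelow n)

costWith : (ℕ → ℕ) → ℕ × ℕ → ℕ
costWith c p = c (proj₁ p) + c (proj₂ p)

∈-splittings⁻ : ∀ n {a b} → (a , b) ∈ splittings n →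
  1 ≤ a × a ≤ n ∸ 1 × 1 ≤ b × b ≤ n ∸ 1 × T (isSplitting n a b)
∈-splittings⁻ n ab∈
  with find (∈-concatMap⁻ (λ a → concatMap (splittingIf n a) (positivesBelow n)) {positivesBelow n} ab∈)
... | a , a∈ , ab∈′ with find (∈-concatMap⁻ (splittingIf n a) {positivesBelow n} ab∈′)
... | b , b∈ , ab∈″ with isSplitting n a b in split
... | true with ab∈″
... | here refl with ∈-map⁻ suc a∈ | ∈-map⁻ suc b∈
... | i , i∈ , refl | j , j∈ , refl = s≤s z≤n , ∈-upTo⁻ i∈ , s≤s z≤n , ∈-upTo⁻ j∈ , subst T (sym split) _

∈-splittings⁺ : ∀ n {a b} → 1 ≤ a → a ≤ n ∸ 1 → 1 ≤ b → b ≤ n ∸ 1 → T (isSplitting n a b) →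
  (a , b) ∈ splittings n
∈-splittings⁺ n {suc a} {suc b} _ a≤ _ b≤ split =
  ∈-concatMap⁺ (λ a → concatMap (splittingIf n a) (positivesBelow n))
    (Any.map (λ { refl → ∈-concatMap⁺ (splittingIf n (suc a)) (Any.map (λ { refl → selected split }) b∈) })
             a∈)
  where
  a∈ : suc a ∈ positivesBelow n
  a∈ = ∈-map⁺ suc (∈-upTo⁺ a≤)
  b∈ : suc b ∈ positivesBelow n
  b∈ = ∈-map⁺ suc (∈-upTo⁺ b≤)
  selected : T (isSplitting n (suc a) (suc b)) → (suc a , suc b) ∈ splittingIf n (suc a) (suc b)
  selected _ with isSplitting n (suc a) (suc b)
  ... | true = here refl

cx-step : ∀ f m → cx (suc f) (2 + m) ≡
  foldr _⊓_ (cx f 1 + cx f (suc m)) (map (costWith (cx f)) (splittings (2 + m)))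
cx-step f m = sym (foldr-map _⊓_ (costWith (cx f)) _ (splittings (2 + m)))

cx-fuel : ∀ {f g n} → n ≤ f → n ≤ g → cx f n ≡ cx g n
cx-fuel {zero}  {zero}  {n}     _ _ = refl
cx-fuel {zero}  {suc g} {zero}  _ _ = refl
cx-fuel {suc f} {zero}  {zero}  _ _ = refl
cx-fuel {suc f} {suc g} {zero}  _ _ = refl
cx-fuel {suc f} {suc g} {suc zero} _ _ = refl
cx-fuel {suc f} {suc g} {suc (suc m)} (s≤s m<f) (s≤s m<g) = begin
  cx (suc f) (2 + m)
    ≡⟨ cx-step f m ⟩
  foldr _⊓_ (cx f 1 + cx f (suc m)) (map (costWith (cx f)) (splittings (2 + m)))
    ≡⟨ cong₂ (foldr _⊓_) (cong₂ _+_ (cx-fuel 1≤f 1≤g) (cx-fuel m<f m<g))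
                         (map-cong-local (All.tabulate same-cost)) ⟩
  foldr _⊓_ (cx g 1 + cx g (suc m)) (map (costWith (cx g)) (splittings (2 + m)))
    ≡⟨ sym (cx-step g m) ⟩
  cx (suc g) (2 + m) ∎
  where
  open ≡-Reasoning
  1≤f = ≤-trans (s≤s z≤n) m<f
  1≤g = ≤-trans (s≤s z≤n) m<g
  same-cost : ∀ {p} → p ∈ splittings (2 + m) → costWith (cx f) p ≡ costWith (cx g) p
  same-cost p∈ with ∈-splittings⁻ (2 + m) p∈
  ... | _ , a≤ , _ , b≤ , _ =
    cong₂ _+_ (cx-fuel (≤-trans a≤ m<f) (≤-trans a≤ m<g)) (cx-fuel (≤-trans b≤ m<f) (≤-trans b≤ m<g))

cost : ℕ × ℕ → ℕ
cost = costWith ‖_‖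

‖‖-unfold : ∀ m → ‖ 2 + m ‖ ≡ foldr _⊓_ (1 + ‖ suc m ‖) (map cost (splittings (2 + m)))
‖‖-unfold m = trans (cx-step (suc m) m)
  (cong (foldr _⊓_ (1 + ‖ suc m ‖)) (map-cong-local (All.tabulate fuel-free)))
  where
  fuel-free : ∀ {p} → p ∈ splittings (2 + m) → costWith (cx (suc m)) p ≡ cost p
  fuel-free p∈ with ∈-splittings⁻ (2 + m) p∈
  ... | _ , a≤ , _ , b≤ , _ = cong₂ _+_ (cx-fuel a≤ ≤-refl) (cx-fuel b≤ ≤-refl)

isSplitting-sound : ∀ n a b → T (isSplitting n a b) → a + b ≡ n ⊎ a * b ≡ n
isSplitting-sound n a b split with Equivalence.to T-∨ split
... | inj₁ sum≡ = inj₁ (≡ᵇ⇒≡ (a + b) n sum≡)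
... | inj₂ product≡ = inj₂ (≡ᵇ⇒≡ (a * b) n product≡)

isSplitting-+ : ∀ a b → T (isSplitting (a + b) a b)
isSplitting-+ a b = Equivalence.from T-∨ (inj₁ (≡⇒≡ᵇ (a + b) (a + b) refl))

isSplitting-* : ∀ a b → T (isSplitting (a * b) a b)
isSplitting-* a b = Equivalence.from (T-∨ {a + b ≡ᵇ a * b}) (inj₂ (≡⇒≡ᵇ (a * b) (a * b) refl))

‖‖-≤-splitting : ∀ {n a b} → 2 ≤ n → 1 ≤ a → a < n → 1 ≤ b → b < n →
  T (isSplitting n a b) → ‖ n ‖ ≤ ‖ a ‖ + ‖ b ‖
‖‖-≤-splitting {suc zero} (s≤s ())
‖‖-≤-splitting {suc (suc m)} {a} {b} _ 1≤a a<n 1≤b b<n split =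
  subst (_≤ cost (a , b)) (sym (‖‖-unfold m))
    (All.lookup (foldr-forcesᵇ ⊓-forces _ (map cost (splittings (2 + m))) ≤-refl)
                (∈-map⁺ cost (∈-splittings⁺ (2 + m) 1≤a (≤-pred a<n) 1≤b (≤-pred b<n) split)))
  where
  ⊓-forces : ∀ {v} x y → v ≤ x ⊓ y → v ≤ x × v ≤ y
  ⊓-forces x y v≤ = ≤-trans v≤ (m⊓n≤m x y) , ≤-trans v≤ (m⊓n≤n x y)

‖‖-+-≤ : ∀ {a b} → 1 ≤ a → 1 ≤ b → ‖ a + b ‖ ≤ ‖ a ‖ + ‖ b ‖
‖‖-+-≤ {a} {b} 1≤a 1≤b =
  ‖‖-≤-splitting (+-mono-≤ 1≤a 1≤b) 1≤a (m<m+n a 1≤b) 1≤b (m<n+m b 1≤a) (isSplitting-+ a b)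

‖‖-*-≤ : ∀ {a b} → 1 ≤ a → 1 ≤ b → ‖ a * b ‖ ≤ ‖ a ‖ + ‖ b ‖
‖‖-*-≤ {suc zero} {b} _ _ = subst (_≤ 1 + ‖ b ‖) (cong ‖_‖ (sym (*-identityˡ b))) (n≤1+n ‖ b ‖)
‖‖-*-≤ {a@(suc (suc _))} {suc zero} _ _ =
  subst (_≤ ‖ a ‖ + 1) (cong ‖_‖ (sym (*-identityʳ a))) (m≤m+n ‖ a ‖ 1)
‖‖-*-≤ {a@(suc (suc _))} {b@(suc (suc _))} _ _ =
  ‖‖-≤-splitting (≤-trans (s≤s (s≤s z≤n)) (m≤m*n a b)) (s≤s z≤n) (m<m*n a b (s≤s (s≤s z≤n)))
    (s≤s z≤n) (subst (b <_) (*-comm b a) (m<m*n b a (s≤s (s≤s z≤n)))) (isSplitting-* a b)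

-- Solid n unfolds to ¬ GoodSum n.
GoodSum : ℕ → Set
GoodSum n = ∃[ u ] ∃[ v ] (1 ≤ u × 1 ≤ v × u + v ≡ n × ‖ n ‖ ≡ ‖ u ‖ + ‖ v ‖)

Reducible : ℕ → Set
Reducible n = ∃[ u ] ∃[ v ] (2 ≤ u × 2 ≤ v × u * v ≡ n × ‖ n ‖ ≡ ‖ u ‖ + ‖ v ‖)

proper-factor : ∀ {a b n} → a * b ≡ n → b < n → 2 ≤ a
proper-factor {zero} refl ()
proper-factor {suc zero} {b} refl b<n = ⊥-elim (<-irrefl (sym (+-identityʳ b)) b<n)
proper-factor {suc (suc a)} _ _ = s≤s (s≤s z≤n)

factors< : ∀ {u v n} → 2 ≤ u → 2 ≤ v → u * v ≡ n → u < n × v < n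
factors< {u@(suc _)} {v@(suc _)} 2≤u 2≤v refl =
  m<m*n u v 2≤v , subst (v <_) (*-comm v u) (m<m*n v u 2≤u)

‖‖-attained : ∀ {n} → 2 ≤ n → GoodSum n ⊎ Reducible n
‖‖-attained {suc zero} (s≤s ())
‖‖-attained {suc (suc m)} _
  with foldr-selective ⊓-sel (1 + ‖ suc m ‖) (map cost (splittings (2 + m)))
... | inj₁ ‖n‖≡ = inj₁ (1 , suc m , s≤s z≤n , s≤s z≤n , refl , trans (‖‖-unfold m) ‖n‖≡)
... | inj₂ ∈costs with ∈-map⁻ cost ∈costs
... | (a , b) , ab∈ , ‖n‖≡ with ∈-splittings⁻ (2 + m) ab∈
... | 1≤a , a≤ , 1≤b , b≤ , split with isSplitting-sound (2 + m) a b split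
... | inj₁ a+b≡n = inj₁ (a , b , 1≤a , 1≤b , a+b≡n , trans (‖‖-unfold m) ‖n‖≡)
... | inj₂ a*b≡n = inj₂ (a , b , proper-factor a*b≡n (s≤s b≤) ,
                         proper-factor (trans (*-comm b a) a*b≡n) (s≤s a≤) , a*b≡n , trans (‖‖-unfold m) ‖n‖≡)

^-distribʳ-* : ∀ a b k → (a * b) ^ k ≡ a ^ k * b ^ k
^-distribʳ-* a b zero = refl
^-distribʳ-* a b (suc k) = begin
  a * b * (a * b) ^ k     ≡⟨ cong (a * b *_) (^-distribʳ-* a b k) ⟩
  a * b * (a ^ k * b ^ k) ≡⟨ interchange a b (a ^ k) (b ^ k) ⟩
  a * a ^ k * (b * b ^ k) ∎
  where
  open ≡-Reasoning
  interchange : ∀ w x y z → w * x * (y * z) ≡ w * y * (x * z)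
  interchange = solve-∀

succ-cube≤ : ∀ c → (3 + c + 1) ^ 3 ≤ 3 * (3 + c) ^ 3
succ-cube≤ c = subst ((3 + c + 1) ^ 3 ≤_) (sym (expand c)) (m≤m+n _ _)
  where
  expand : ∀ c → 3 * ((3 + c) * ((3 + c) * ((3 + c) * 1))) ≡
           (3 + c + 1) * ((3 + c + 1) * ((3 + c + 1) * 1)) + (17 + 33 * c + 15 * c * c + 2 * c * c * c)
  expand = solve-∀

cube≤3^‖‖-+1 : ∀ {a} → 1 ≤ a → a ^ 3 ≤ 3 ^ ‖ a ‖ → (a + 1) ^ 3 ≤ 3 ^ (‖ a ‖ + 1)
cube≤3^‖‖-+1 {a} 1≤a a³≤ rewrite +-comm ‖ a ‖ 1 = go 1≤a a³≤
  where
  go : ∀ {a} → 1 ≤ a → a ^ 3 ≤ 3 ^ ‖ a ‖ → (a + 1) ^ 3 ≤ 3 * 3 ^ ‖ a ‖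
  go {1} _ _ = m≤m+n 8 1
  go {2} _ _ = ≤-refl
  go {suc (suc (suc c))} _ a³≤ = ≤-trans (succ-cube≤ c) (*-monoʳ-≤ 3 a³≤)

+≤* : ∀ a b → 2 + a + (2 + b) ≤ (2 + a) * (2 + b)
+≤* a b = subst (2 + a + (2 + b) ≤_) (sym (expand a b)) (m≤m+n _ _)
  where
  expand : ∀ a b → (2 + a) * (2 + b) ≡ 2 + a + (2 + b) + (a + b + a * b)
  expand = solve-∀

cube≤3^‖‖-* : ∀ a b → a ^ 3 ≤ 3 ^ ‖ a ‖ → b ^ 3 ≤ 3 ^ ‖ b ‖ →
  (a * b) ^ 3 ≤ 3 ^ (‖ a ‖ + ‖ b ‖)
cube≤3^‖‖-* a b a³≤ b³≤ rewrite ^-distribʳ-* a b 3 | ^-distribˡ-+-* 3 ‖ a ‖ ‖ b ‖ =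
  *-mono-≤ a³≤ b³≤

cube≤3^‖‖-+ : ∀ {a b} → 1 ≤ a → 1 ≤ b → a ^ 3 ≤ 3 ^ ‖ a ‖ → b ^ 3 ≤ 3 ^ ‖ b ‖ →
  (a + b) ^ 3 ≤ 3 ^ (‖ a ‖ + ‖ b ‖)
cube≤3^‖‖-+ {b = 1} 1≤a _ a³≤ _ = cube≤3^‖‖-+1 1≤a a³≤
cube≤3^‖‖-+ {1} {b} _ 1≤b _ b³≤ =
  subst₂ (λ x y → x ^ 3 ≤ 3 ^ y) (+-comm b 1) (+-comm ‖ b ‖ 1) (cube≤3^‖‖-+1 1≤b b³≤)
cube≤3^‖‖-+ {suc (suc a)} {suc (suc b)} _ _ a³≤ b³≤ =
  ≤-trans (^-monoˡ-≤ 3 (+≤* a b)) (cube≤3^‖‖-* (2 + a) (2 + b) a³≤ b³≤)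

cube≤3^‖‖ : ∀ {n} → 1 ≤ n → n ^ 3 ≤ 3 ^ ‖ n ‖
cube≤3^‖‖ {n} = <-rec (λ n → 1 ≤ n → n ^ 3 ≤ 3 ^ ‖ n ‖) step n
  where
  step : ∀ n → (∀ {m} → m < n → 1 ≤ m → m ^ 3 ≤ 3 ^ ‖ m ‖) → 1 ≤ n → n ^ 3 ≤ 3 ^ ‖ n ‖
  step 1 _ _ = s≤s z≤n
  step n@(suc (suc _)) rec _ with ‖‖-attained {n} (s≤s (s≤s z≤n))
  ... | inj₁ (a , b , 1≤a , 1≤b , a+b≡n , ‖n‖≡) =
    subst₂ (λ x c → x ^ 3 ≤ 3 ^ c) a+b≡n (sym ‖n‖≡)
      (cube≤3^‖‖-+ 1≤a 1≤b (rec (subst (a <_) a+b≡n (m<m+n a 1≤b)) 1≤a)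
                              (rec (subst (b <_) a+b≡n (m<n+m b 1≤a)) 1≤b))
  ... | inj₂ (a , b , 2≤a , 2≤b , a*b≡n , ‖n‖≡) =
    subst₂ (λ x c → x ^ 3 ≤ 3 ^ c) a*b≡n (sym ‖n‖≡)
      (cube≤3^‖‖-* a b (rec (proj₁ (factors< 2≤a 2≤b a*b≡n)) (≤-trans (s≤s z≤n) 2≤a))
                   (rec (proj₂ (factors< 2≤a 2≤b a*b≡n)) (≤-trans (s≤s z≤n) 2≤b)))

-- Good factorizations

record GoodPair (n u v : ℕ) : Set where
  field
    pos₁     : 1 ≤ u
    pos₂     : 1 ≤ v
    product≡ : u * v ≡ n
    ‖‖≡      : ‖ n ‖ ≡ ‖ u ‖ + ‖ v ‖

goodPair-≤ : ∀ {n u v} → 1 ≤ u → 1 ≤ v → u * v ≡ n → ‖ u ‖ + ‖ v ‖ ≤ ‖ n ‖ → GoodPair n u v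
goodPair-≤ 1≤u 1≤v refl ≤‖n‖ = record
  { pos₁ = 1≤u ; pos₂ = 1≤v ; product≡ = refl ; ‖‖≡ = ≤-antisym (‖‖-*-≤ 1≤u 1≤v) ≤‖n‖ }

GoodPair-sym : ∀ {n u v} → GoodPair n u v → GoodPair n v u
GoodPair-sym {u = u} {v} g = record
  { pos₁ = pos₂ ; pos₂ = pos₁
  ; product≡ = trans (*-comm v u) product≡ ; ‖‖≡ = trans ‖‖≡ (+-comm ‖ u ‖ ‖ v ‖) }
  where open GoodPair g

GoodPair⇒GoodFact : ∀ {n u v} → GoodPair n u v → GoodFact n (u ∷ v ∷ [])
GoodPair⇒GoodFact {u = u} {v} g =
  (pos₁ ∷ pos₂ ∷ []) , trans (cong (u *_) (*-identityʳ v)) product≡ ,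
  trans ‖‖≡ (cong (‖ u ‖ +_) (sym (+-identityʳ ‖ v ‖)))
  where open GoodPair g

GoodFact⇒GoodPair : ∀ {n u v} → GoodFact n (u ∷ v ∷ []) → GoodPair n u v
GoodFact⇒GoodPair {u = u} {v} ((1≤u ∷ 1≤v ∷ []) , product≡ , ‖‖≡) = record
  { pos₁ = 1≤u ; pos₂ = 1≤v
  ; product≡ = trans (cong (u *_) (sym (*-identityʳ v))) product≡
  ; ‖‖≡ = trans ‖‖≡ (cong (‖ u ‖ +_) (+-identityʳ ‖ v ‖)) }

GoodPair-nontrivial : ∀ {n u v} → GoodPair n u v → 2 ≤ u
GoodPair-nontrivial {n} {suc zero} {v} g = ⊥-elim (1+n≰n (≤-reflexive (begin
  1 + ‖ n ‖ ≡⟨ cong (λ m → 1 + ‖ m ‖) (sym product≡) ⟩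
  1 + ‖ v + 0 ‖ ≡⟨ cong (λ m → 1 + ‖ m ‖) (+-identityʳ v) ⟩
  1 + ‖ v ‖ ≡⟨ sym ‖‖≡ ⟩
  ‖ n ‖ ∎)))
  where
  open GoodPair g
  open ≡-Reasoning
GoodPair-nontrivial {u = suc (suc _)} _ = s≤s (s≤s z≤n)
GoodPair-nontrivial {u = zero} g with GoodPair.pos₁ g
... | ()

GoodPair⇒Reducible : ∀ {n u v} → GoodPair n u v → Reducible n
GoodPair⇒Reducible {u = u} {v} g = u , v , GoodPair-nontrivial g ,
  GoodPair-nontrivial (GoodPair-sym g) , GoodPair.product≡ g , GoodPair.‖‖≡ g

product-pos : ∀ zs → All (1 ≤_) zs → 1 ≤ product zs
product-pos [] [] = s≤s z≤n
product-pos (z ∷ zs) (1≤z ∷ 1≤zs) = *-mono-≤ 1≤z (product-pos zs 1≤zs)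

‖product‖≤sum : ∀ x xs → All (1 ≤_) (x ∷ xs) → ‖ product (x ∷ xs) ‖ ≤ sum (map ‖_‖ (x ∷ xs))
‖product‖≤sum x [] _ rewrite *-identityʳ x | +-identityʳ ‖ x ‖ = ≤-refl
‖product‖≤sum x (y ∷ ys) (1≤x ∷ 1≤ys) =
  ≤-trans (‖‖-*-≤ 1≤x (product-pos (y ∷ ys) 1≤ys)) (+-monoʳ-≤ ‖ x ‖ (‖product‖≤sum y ys 1≤ys))

goodFact-≤ : ∀ {n} u us → All (1 ≤_) (u ∷ us) → product (u ∷ us) ≡ n →
  sum (map ‖_‖ (u ∷ us)) ≤ ‖ n ‖ → GoodFact n (u ∷ us)
goodFact-≤ u us 1≤us refl ≤‖n‖ = 1≤us , refl , ≤-antisym (‖product‖≤sum u us 1≤us) ≤‖n‖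

GoodFact-head : ∀ {n x y ys} → GoodFact n (x ∷ y ∷ ys) → GoodPair n x (product (y ∷ ys))
GoodFact-head {x = x} {y} {ys} ((1≤x ∷ 1≤ys) , product≡ , ‖n‖≡) =
  goodPair-≤ 1≤x (product-pos (y ∷ ys) 1≤ys) product≡
    (subst (_ ≤_) (sym ‖n‖≡) (+-monoʳ-≤ ‖ x ‖ (‖product‖≤sum y ys 1≤ys)))

GoodFact-swap : ∀ {n x y ys} → GoodFact n (x ∷ y ∷ ys) → GoodFact n (y ∷ x ∷ ys)
GoodFact-swap {x = x} {y} {ys} ((1≤x ∷ 1≤y ∷ 1≤ys) , product≡ , ‖n‖≡) =
  (1≤y ∷ 1≤x ∷ 1≤ys) , trans (swap-* x y (product ys)) product≡ ,
  trans ‖n‖≡ (swap-+ ‖ x ‖ ‖ y ‖ (sum (map ‖_‖ ys)))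
  where
  swap-* : ∀ a b c → b * (a * c) ≡ a * (b * c)
  swap-* = solve-∀
  swap-+ : ∀ a b c → a + (b + c) ≡ b + (a + c)
  swap-+ = solve-∀

GoodFact-merge : ∀ {n x y ys} → GoodFact n (x ∷ y ∷ ys) → GoodFact n (x * y ∷ ys) × GoodPair (x * y) x y
GoodFact-merge {n} {x} {y} {ys} ((1≤x ∷ 1≤y ∷ 1≤ys) , product≡ , ‖n‖≡) =
  goodFact-≤ (x * y) ys (*-mono-≤ 1≤x 1≤y ∷ 1≤ys) (trans (*-assoc x y _) product≡) merged≤ ,
  goodPair-≤ 1≤x 1≤y refl (+-cancelʳ-≤ rest _ _ (begin
    ‖ x ‖ + ‖ y ‖ + rest ≡⟨ +-assoc ‖ x ‖ ‖ y ‖ rest ⟩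
    ‖ x ‖ + (‖ y ‖ + rest) ≡⟨ sym ‖n‖≡ ⟩
    ‖ n ‖ ≤⟨ subst (λ m → ‖ m ‖ ≤ ‖ x * y ‖ + rest) (trans (*-assoc x y _) product≡)
               (‖product‖≤sum (x * y) ys (*-mono-≤ 1≤x 1≤y ∷ 1≤ys)) ⟩
    ‖ x * y ‖ + rest ∎))
  where
  open ≤-Reasoning
  rest = sum (map ‖_‖ ys)
  merged≤ : ‖ x * y ‖ + rest ≤ ‖ n ‖
  merged≤ = begin
    ‖ x * y ‖ + rest ≤⟨ +-monoˡ-≤ rest (‖‖-*-≤ 1≤x 1≤y) ⟩
    ‖ x ‖ + ‖ y ‖ + rest ≡⟨ +-assoc ‖ x ‖ ‖ y ‖ rest ⟩
    ‖ x ‖ + (‖ y ‖ + rest) ≡⟨ sym ‖n‖≡ ⟩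
    ‖ n ‖ ∎

GoodFact-collapse₃ : ∀ {n x y z zs} → GoodFact n (x ∷ y ∷ z ∷ zs) →
  GoodFact n (x ∷ y ∷ product (z ∷ zs) ∷ [])
GoodFact-collapse₃ {n} {x} {y} {z} {zs} ((1≤x ∷ 1≤y ∷ 1≤zs) , product≡ , ‖n‖≡) =
  goodFact-≤ x (y ∷ p ∷ []) (1≤x ∷ 1≤y ∷ product-pos (z ∷ zs) 1≤zs ∷ [])
    (trans (cong (λ m → x * (y * m)) (*-identityʳ p)) product≡)
    (subst (‖ x ‖ + (‖ y ‖ + (‖ p ‖ + 0)) ≤_) (sym ‖n‖≡) (+-monoʳ-≤ ‖ x ‖ (+-monoʳ-≤ ‖ y ‖
      (subst (_≤ sum (map ‖_‖ (z ∷ zs))) (sym (+-identityʳ ‖ p ‖)) (‖product‖≤sum z zs 1≤zs)))))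
  where
  p = product (z ∷ zs)

GoodFact-++ : ∀ {n u v xs ys} → GoodPair n u v → GoodFact u xs → GoodFact v ys → GoodFact n (xs ++ ys)
GoodFact-++ {xs = xs} {ys} g (1≤xs , product-xs , ‖u‖≡) (1≤ys , product-ys , ‖v‖≡) =
  ++⁺ 1≤xs 1≤ys ,
  trans (product-++ xs ys) (trans (cong₂ _*_ product-xs product-ys) product≡) ,
  trans ‖‖≡ (trans (cong₂ _+_ ‖u‖≡ ‖v‖≡)
    (trans (sym (sum-++ (map ‖_‖ xs) (map ‖_‖ ys))) (cong sum (sym (map-++ ‖_‖ xs ys)))))
  where open GoodPair g

Leader-factorʳ : ∀ {n u v} → Leader n → GoodPair n u v → Leader v
Leader-factorʳ leader g (divides zero refl , _) with GoodPair.pos₂ g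
... | ()
Leader-factorʳ {n} {u} {v} leader g (divides c@(suc _) refl , ‖v‖≡) =
  leader (divides (u * c) n≡uc3 , subst (λ m → ‖ n ‖ ≡ 3 + ‖ m ‖) (sym n/3≡uc) (≤-antisym upper lower))
  where
  open GoodPair g
  open ≤-Reasoning
  n≡uc3 : n ≡ u * c * 3
  n≡uc3 = trans (sym product≡) (sym (*-assoc u c 3))
  n/3≡uc : n / 3 ≡ u * c
  n/3≡uc = trans (cong (_/ 3) n≡uc3) (m*n/n≡m (u * c) 3)
  ‖v‖≡3+‖c‖ : ‖ c * 3 ‖ ≡ 3 + ‖ c ‖
  ‖v‖≡3+‖c‖ = trans ‖v‖≡ (cong (λ m → 3 + ‖ m ‖) (m*n/n≡m c 3))
  1≤c : 1 ≤ c
  1≤c = s≤s z≤n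
  upper : ‖ n ‖ ≤ 3 + ‖ u * c ‖
  upper = begin
    ‖ n ‖ ≡⟨ cong ‖_‖ n≡uc3 ⟩
    ‖ u * c * 3 ‖ ≤⟨ ‖‖-*-≤ (*-mono-≤ pos₁ 1≤c) (s≤s z≤n) ⟩
    ‖ u * c ‖ + 3 ≡⟨ +-comm ‖ u * c ‖ 3 ⟩
    3 + ‖ u * c ‖ ∎
  lower : 3 + ‖ u * c ‖ ≤ ‖ n ‖
  lower = begin
    3 + ‖ u * c ‖ ≤⟨ +-monoʳ-≤ 3 (‖‖-*-≤ pos₁ 1≤c) ⟩
    3 + (‖ u ‖ + ‖ c ‖) ≡⟨ +-comm 3 (‖ u ‖ + ‖ c ‖) ⟩
    ‖ u ‖ + ‖ c ‖ + 3 ≡⟨ +-assoc ‖ u ‖ ‖ c ‖ 3 ⟩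
    ‖ u ‖ + (‖ c ‖ + 3) ≡⟨ cong (‖ u ‖ +_) (trans (+-comm ‖ c ‖ 3) (sym ‖v‖≡3+‖c‖)) ⟩
    ‖ u ‖ + ‖ c * 3 ‖ ≡⟨ sym ‖‖≡ ⟩
    ‖ n ‖ ∎

-- Irreducible numbers and solid summands

Reducible? : ∀ n → Dec (Reducible n)
Reducible? n = map′ unbound bound
  (anyUpTo? (λ u → anyUpTo? (λ v →
    (2 ≤? u) ×-dec (2 ≤? v) ×-dec (u * v ≟ n) ×-dec (‖ n ‖ ≟ ‖ u ‖ + ‖ v ‖)) (suc n)) (suc n))
  where
  unbound : (∃ λ u → u < suc n × ∃ λ v → v < suc n × _) → Reducible n
  unbound (u , _ , v , _ , r) = u , v , r
  bound : Reducible n → ∃ λ u → u < suc n × ∃ λ v → v < suc n × _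
  bound (u , v , 2≤u , 2≤v , u*v≡n , ‖n‖≡) = let u<n , v<n = factors< 2≤u 2≤v u*v≡n in
    u , m<n⇒m<1+n u<n , v , m<n⇒m<1+n v<n , 2≤u , 2≤v , u*v≡n , ‖n‖≡

Irreducible : ℕ → Set
Irreducible n = 2 ≤ n × ¬ Reducible n

¬Reducible⇒MultIrred : ∀ {n} → ¬ Reducible n → MultIrred n
¬Reducible⇒MultIrred irreducible (x ∷ y ∷ ys) _ good =
  irreducible (GoodPair⇒Reducible (GoodFact-head good))
¬Reducible⇒MultIrred _ (_ ∷ []) (s≤s ())

Reducible⇒GoodPair : ∀ {n} → Reducible n → ∃[ u ] ∃[ v ] (2 ≤ u × 2 ≤ v × GoodPair n u v)
Reducible⇒GoodPair (u , v , 2≤u , 2≤v , u*v≡n , ‖n‖≡) = u , v , 2≤u , 2≤v , record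
  { pos₁ = ≤-trans (s≤s z≤n) 2≤u ; pos₂ = ≤-trans (s≤s z≤n) 2≤v ; product≡ = u*v≡n ; ‖‖≡ = ‖n‖≡ }

Factorization : ℕ → Set
Factorization n = ∃ λ x → ∃ λ xs → GoodFact n (x ∷ xs) × All Irreducible (x ∷ xs)

Factorization₂ : ℕ → Set
Factorization₂ n = ∃ λ x → ∃ λ y → ∃ λ ys → GoodFact n (x ∷ y ∷ ys) × All Irreducible (x ∷ y ∷ ys)

factorization-++ : ∀ {n u v} → GoodPair n u v → Factorization u → Factorization v → Factorization₂ n
factorization-++ g (x , xs , good-u , irr-u) (y , ys , good-v , irr-v)
  with GoodFact-++ g good-u good-v | ++⁺ irr-u irr-v
factorization-++ g (x , [] , _) (y , ys , _) | good | irr = x , y , ys , good , irr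
factorization-++ g (x , x′ ∷ xs , _) (y , ys , _) | good | irr = x , x′ , xs ++ y ∷ ys , good , irr

factorization : ∀ {n} → 2 ≤ n → Factorization n
factorization {n} = <-rec (λ n → 2 ≤ n → Factorization n) step n
  where
  step : ∀ n → (∀ {m} → m < n → 2 ≤ m → Factorization m) → 2 ≤ n → Factorization n
  step n rec 2≤n with Reducible? n
  ... | no irreducible = n , [] , ((≤-trans (s≤s z≤n) 2≤n ∷ []) , *-identityʳ n , sym (+-identityʳ ‖ n ‖)) ,
                         (2≤n , irreducible) ∷ []
  ... | yes reducible with Reducible⇒GoodPair reducible
  ... | u , v , 2≤u , 2≤v , good with factors< 2≤u 2≤v (GoodPair.product≡ good)
  ... | u<n , v<n with factorization-++ good (rec u<n 2≤u) (rec v<n 2≤v)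
  ... | x , y , ys , good′ , irr = x , y ∷ ys , good′ , irr

reducible-factorization : ∀ {n} → Reducible n → Factorization₂ n
reducible-factorization reducible with Reducible⇒GoodPair reducible
... | u , v , 2≤u , 2≤v , good = factorization-++ good (factorization 2≤u) (factorization 2≤v)

GoodSum? : ∀ n → Dec (GoodSum n)
GoodSum? n = map′ complement bound
  (anyUpTo? (λ u → (1 ≤? u) ×-dec (1 ≤? n ∸ u) ×-dec (‖ n ‖ ≟ ‖ u ‖ + ‖ n ∸ u ‖)) n)
  where
  SplitsAt : ℕ → Set
  SplitsAt u = 1 ≤ u × 1 ≤ n ∸ u × ‖ n ‖ ≡ ‖ u ‖ + ‖ n ∸ u ‖
  complement : (∃ λ u → u < n × SplitsAt u) → GoodSum n
  complement (u , u<n , 1≤u , 1≤n-u , ‖n‖≡) = u , n ∸ u , 1≤u , 1≤n-u , m+[n∸m]≡n (<⇒≤ u<n) , ‖n‖≡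
  bound : GoodSum n → ∃ λ u → u < n × SplitsAt u
  bound (u , v , 1≤u , 1≤v , refl , ‖n‖≡) =
    u , m<m+n u 1≤v , 1≤u , subst (1 ≤_) (sym (m+n∸m≡n u v)) 1≤v ,
    subst (λ w → ‖ u + v ‖ ≡ ‖ u ‖ + ‖ w ‖) (sym (m+n∸m≡n u v)) ‖n‖≡

SolidSplit : ℕ → Set
SolidSplit n = ∃ λ a → ∃ λ b → 1 ≤ b × a + b ≡ n × ‖ n ‖ ≡ ‖ a ‖ + ‖ b ‖ × b ≤ a × Solid b

GoodSum-shift : ∀ {n a b c} → 1 ≤ a → 1 ≤ b → 1 ≤ c → a + (b + c) ≡ n →
  ‖ n ‖ ≡ ‖ a ‖ + ‖ b + c ‖ → ‖ b + c ‖ ≡ ‖ b ‖ + ‖ c ‖ → ‖ n ‖ ≡ ‖ a + b ‖ + ‖ c ‖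
GoodSum-shift {n} {a} {b} {c} 1≤a 1≤b 1≤c refl ‖n‖≡ ‖b+c‖≡ = ≤-antisym
  (subst (λ m → ‖ m ‖ ≤ ‖ a + b ‖ + ‖ c ‖) (+-assoc a b c) (‖‖-+-≤ (≤-trans 1≤a (m≤m+n a b)) 1≤c))
  (begin
    ‖ a + b ‖ + ‖ c ‖ ≤⟨ +-monoˡ-≤ ‖ c ‖ (‖‖-+-≤ 1≤a 1≤b) ⟩
    ‖ a ‖ + ‖ b ‖ + ‖ c ‖ ≡⟨ +-assoc (‖ a ‖) (‖ b ‖) (‖ c ‖) ⟩
    ‖ a ‖ + (‖ b ‖ + ‖ c ‖) ≡⟨ cong (‖ a ‖ +_) (sym ‖b+c‖≡) ⟩
    ‖ a ‖ + ‖ b + c ‖ ≡⟨ sym ‖n‖≡ ⟩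
    ‖ a + (b + c) ‖ ∎)
  where open ≤-Reasoning

-- Splitting off a good summand of a non-solid summand b moves the rest of b into a and strictly shrinks b.
GoodSum⇒SolidSplit : ∀ {n} → GoodSum n → SolidSplit n
GoodSum⇒SolidSplit {n} (a , b , 1≤a , 1≤b , a+b≡n , ‖n‖≡) = <-rec P step b a 1≤a 1≤b a+b≡n ‖n‖≡
  where
  P : ℕ → Set
  P b = ∀ a → 1 ≤ a → 1 ≤ b → a + b ≡ n → ‖ n ‖ ≡ ‖ a ‖ + ‖ b ‖ → SolidSplit n
  step : ∀ b → (∀ {b′} → b′ < b → P b′) → P b
  step b rec a 1≤a 1≤b a+b≡n ‖n‖≡ with b ≤? a
  ... | no b≰a = rec (≰⇒> b≰a) b 1≤b 1≤a (trans (+-comm b a) a+b≡n) (trans ‖n‖≡ (+-comm ‖ a ‖ ‖ b ‖))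
  ... | yes b≤a with GoodSum? b
  ... | no solid = a , b , 1≤b , a+b≡n , ‖n‖≡ , b≤a , solid
  ... | yes (b₁ , b₂ , 1≤b₁ , 1≤b₂ , refl , ‖b‖≡) =
    rec (m<n+m b₂ 1≤b₁) (a + b₁) (≤-trans 1≤a (m≤m+n a b₁)) 1≤b₂
      (trans (+-assoc a b₁ b₂) a+b≡n) (GoodSum-shift 1≤a 1≤b₁ 1≤b₂ a+b≡n ‖n‖≡ ‖b‖≡)

Solid-1 : Solid 1
Solid-1 (u , v , 1≤u , 1≤v , u+v≡1 , _) = <-irrefl (sym u+v≡1) (+-mono-≤ 1≤u 1≤v)

Solid⇒3≤ : ∀ {b} → Solid b → 2 ≤ b → 3 ≤ b
Solid⇒3≤ {suc zero} _ (s≤s ())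
Solid⇒3≤ {suc (suc zero)} solid _ = ⊥-elim (solid (1 , 1 , s≤s z≤n , s≤s z≤n , refl , refl))
Solid⇒3≤ {suc (suc (suc _))} _ _ = s≤s (s≤s (s≤s z≤n))

Irreducible⇒GoodSum : ∀ {n} → Irreducible n → GoodSum n
Irreducible⇒GoodSum (2≤n , irreducible) with ‖‖-attained 2≤n
... | inj₁ sum = sum
... | inj₂ reducible = ⊥-elim (irreducible reducible)

LargeSolidSummand : ℕ → Set
LargeSolidSummand u = ∃[ b ] (Solid b × 1 < b × 2 * b ≤ u × ‖ u ‖ ≡ ‖ u ∸ b ‖ + ‖ b ‖)

LargeSolidSummand? : ∀ u → Dec (LargeSolidSummand u)
LargeSolidSummand? u =
  map′ (λ (b , _ , t) → b , t) (λ (b , t@(_ , _ , 2b≤u , _)) → b , s≤s (≤-trans (m≤m+n b (b + 0)) 2b≤u) , t)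
    (anyUpTo? (λ b → ¬? (GoodSum? b) ×-dec (2 ≤? b) ×-dec (2 * b ≤? u) ×-dec (‖ u ‖ ≟ ‖ u ∸ b ‖ + ‖ b ‖))
              (suc u))

¬LargeSolidSummand⇒+1 : ∀ {u} → Irreducible u → ¬ LargeSolidSummand u → ∃[ a ] (a + 1 ≡ u × ‖ u ‖ ≡ ‖ a ‖ + 1)
¬LargeSolidSummand⇒+1 {u} irr ¬bad with GoodSum⇒SolidSplit (Irreducible⇒GoodSum irr)
... | a , b , 1≤b , a+b≡u , ‖u‖≡ , b≤a , solid with 2 ≤? b
... | yes 2≤b =
  ⊥-elim (¬bad (b , solid , 2≤b , 2b≤u , subst (λ x → ‖ u ‖ ≡ ‖ x ‖ + ‖ b ‖) (sym u-b≡a) ‖u‖≡))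
  where
  2b≤u : 2 * b ≤ u
  2b≤u = subst (2 * b ≤_) a+b≡u (subst (_≤ a + b) (cong (b +_) (sym (+-identityʳ b))) (+-monoˡ-≤ b b≤a))
  u-b≡a : u ∸ b ≡ a
  u-b≡a = trans (cong (_∸ b) (sym a+b≡u)) (m+n∸n≡m a b)
... | no b≱2 with ≤-antisym (≤-pred (≰⇒> b≱2)) 1≤b
... | refl = a , a+b≡u , ‖u‖≡

-- Defects

-- With Q = q + 1, the defect bound δ(x) < m·p/Q is the integer inequality (3^‖x‖)^Q < (x³)^Q · 3^(m·p).
module Defect (p q : ℕ) where

  num : ℕ → ℕ
  num x = (3 ^ ‖ x ‖) ^ suc q

  den : ℕ → ℕ
  den x = (x ^ 3) ^ suc q

  pow3 : ℕ → ℕ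
  pow3 m = 3 ^ (m * p)

  record δ< (m x : ℕ) : Set where
    constructor δ<-intro
    field bound : num x < den x * pow3 m

  δ<? : ∀ m x → Dec (δ< m x)
  δ<? m x = map′ δ<-intro δ<.bound (num x <? den x * pow3 m)

  ¬δ<⇒≥ : ∀ {m x} → ¬ δ< m x → den x * pow3 m ≤ num x
  ¬δ<⇒≥ ¬δ< = ≮⇒≥ (λ lt → ¬δ< (δ<-intro lt))

  pow3-+ : ∀ i j → pow3 (i + j) ≡ pow3 i * pow3 j
  pow3-+ i j = trans (cong (3 ^_) (*-distribʳ-+ p i j)) (^-distribˡ-+-* 3 (i * p) (j * p))

  num-+ : ∀ {n g h} → ‖ n ‖ ≡ ‖ g ‖ + ‖ h ‖ → num n ≡ num g * num h
  num-+ {g = g} {h} ‖n‖≡ rewrite ‖n‖≡ | ^-distribˡ-+-* 3 ‖ g ‖ ‖ h ‖ =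
    ^-distribʳ-* (3 ^ ‖ g ‖) (3 ^ ‖ h ‖) (suc q)

  num-* : ∀ {n g h} → GoodPair n g h → num n ≡ num g * num h
  num-* {n} {g} {h} good = num-+ {n} {g} {h} (GoodPair.‖‖≡ good)

  den-* : ∀ {n g h} → GoodPair n g h → den n ≡ den g * den h
  den-* {g = g} {h} good rewrite sym (GoodPair.product≡ good) | ^-distribʳ-* g h 3 =
    ^-distribʳ-* (g ^ 3) (h ^ 3) (suc q)

  ¬δ<0 : ∀ {x} → 1 ≤ x → ¬ δ< 0 x
  ¬δ<0 {x} 1≤x (δ<-intro lt) = <⇒≱ lt
    (subst (_≤ num x) (sym (*-identityʳ (den x))) (^-monoˡ-≤ (suc q) (cube≤3^‖‖ 1≤x)))

  δ<-mono : ∀ {i j x} → i ≤ j → δ< i x → δ< j x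
  δ<-mono {x = x} i≤j (δ<-intro lt) =
    δ<-intro (<-≤-trans lt (*-monoʳ-≤ (den x) (^-monoʳ-≤ 3 (*-monoˡ-≤ p i≤j))))

  private
    interchange : ∀ w x y z → w * x * (y * z) ≡ w * y * (x * z)
    interchange = solve-∀

  δ<-* : ∀ {i j n g h} → GoodPair n g h → δ< i g → δ< j h → δ< (i + j) n
  δ<-* {i} {j} {n} {g} {h} good (δ<-intro δ<g) (δ<-intro δ<h) = δ<-intro (begin-strict
    num n                             ≡⟨ num-* good ⟩
    num g * num h                     <⟨ *-mono-< δ<g δ<h ⟩
    den g * pow3 i * (den h * pow3 j) ≡⟨ interchange (den g) (pow3 i) (den h) (pow3 j) ⟩
    den g * den h * (pow3 i * pow3 j) ≡⟨ cong₂ _*_ (sym (den-* good)) (sym (pow3-+ i j)) ⟩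
    den n * pow3 (i + j)              ∎)
    where open ≤-Reasoning

  δ<-cancel : ∀ {i j n g h} → GoodPair n g h → δ< (i + j) n → ¬ δ< i g → δ< j h
  δ<-cancel {i} {j} {n} {g} {h} good (δ<-intro δ<n) ¬δ<g =
    δ<-intro (*-cancelˡ-< (den g * pow3 i) (num h) (den h * pow3 j) (begin-strict
    den g * pow3 i * num h            ≤⟨ *-monoˡ-≤ (num h) (¬δ<⇒≥ ¬δ<g) ⟩
    num g * num h                     ≡⟨ sym (num-* good) ⟩
    num n                             <⟨ δ<n ⟩
    den n * pow3 (i + j)              ≡⟨ cong₂ _*_ (den-* good) (pow3-+ i j) ⟩
    den g * den h * (pow3 i * pow3 j) ≡⟨ interchange (den g) (den h) (pow3 i) (pow3 j) ⟩
    den g * pow3 i * (den h * pow3 j) ∎))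
    where open ≤-Reasoning

  δ<-factorʳ : ∀ {m n g h} → GoodPair n g h → δ< m n → δ< m h
  δ<-factorʳ good δ<n = δ<-cancel good δ<n (¬δ<0 (GoodPair.pos₁ good))

  δ<-factorˡ : ∀ {m n g h} → GoodPair n g h → δ< m n → δ< m g
  δ<-factorˡ good = δ<-factorʳ (GoodPair-sym good)

  den-pos : ∀ {x} → 1 ≤ x → 1 ≤ den x
  den-pos {x} 1≤x = subst (_≤ den x) (^-zeroˡ (suc q)) (^-monoˡ-≤ (suc q) (^-monoˡ-≤ 3 1≤x))

  den-sum≤ : ∀ {u a b} → a + b ≡ u → b ≤ a → den u ≤ (8 * a ^ 3) ^ suc q
  den-sum≤ {a = a} {b} refl b≤a =
    ^-monoˡ-≤ (suc q) (subst ((a + b) ^ 3 ≤_) (double-cube a) (^-monoˡ-≤ 3 (+-monoʳ-≤ a b≤a)))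
    where
    double-cube : ∀ a → (a + a) * ((a + a) * ((a + a) * 1)) ≡ 8 * (a * (a * (a * 1)))
    double-cube = solve-∀

  -- Drop u a says δ(a) + p/Q ≤ δ(u).
  Drop : ℕ → ℕ → Set
  Drop u a = num a * den u * pow3 1 ≤ num u * den a

  δ<-drop : ∀ {k u a} → Drop u a → 1 ≤ a → δ< (suc k) u → δ< k a
  δ<-drop {k} {u} {a} drop 1≤a (δ<-intro δ<u) =
    δ<-intro (*-cancelˡ-< (den u * pow3 1) (num a) (den a * pow3 k) (begin-strict
    den u * pow3 1 * num a    ≡⟨ rotate (den u) (pow3 1) (num a) ⟩
    num a * den u * pow3 1    ≤⟨ drop ⟩
    num u * den a             <⟨ *-monoˡ-< (den a) {{>-nonZero (den-pos 1≤a)}} δ<u ⟩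
    den u * pow3 (1 + k) * den a ≡⟨ cong (λ e → den u * e * den a) (pow3-+ 1 k) ⟩
    den u * (pow3 1 * pow3 k) * den a ≡⟨ regroup (den u) (pow3 1) (pow3 k) (den a) ⟩
    den u * pow3 1 * (den a * pow3 k) ∎))
    where
    open ≤-Reasoning
    rotate : ∀ x y z → x * y * z ≡ z * x * y
    rotate = solve-∀
    regroup : ∀ x y z w → x * (y * z) * w ≡ x * y * (w * z)
    regroup = solve-∀

  -- (a + b)³ ≤ 8a³ and 3^‖b‖ ≥ b³ ≥ 27 > 8 · 3^(p/Q): the summand b pays for the drop.
  drop-solid : ∀ {u a b} → p ≤ suc q → a + b ≡ u → ‖ u ‖ ≡ ‖ a ‖ + ‖ b ‖ → b ≤ a → 3 ≤ b → Drop u a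
  drop-solid {u} {a} {b} p≤Q a+b≡u ‖u‖≡ b≤a 3≤b = begin
    num a * den u * pow3 1                  ≤⟨ *-mono-≤ (*-monoʳ-≤ (num a) (den-sum≤ a+b≡u b≤a)) pow3-1≤ ⟩
    num a * (8 * a ^ 3) ^ suc q * 3 ^ suc q ≡⟨ cong (λ x → num a * x * 3 ^ suc q) (^-distribʳ-* 8 (a ^ 3) (suc q)) ⟩
    num a * (8 ^ suc q * den a) * 3 ^ suc q ≡⟨ regroup (num a) (8 ^ suc q) (den a) (3 ^ suc q) ⟩
    num a * den a * (8 ^ suc q * 3 ^ suc q) ≡⟨ cong (num a * den a *_) (sym (^-distribʳ-* 8 3 (suc q))) ⟩
    num a * den a * 24 ^ suc q              ≤⟨ *-monoʳ-≤ (num a * den a) (^-monoˡ-≤ (suc q) 24≤3^‖b‖) ⟩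
    num a * den a * num b                   ≡⟨ swap (num a) (den a) (num b) ⟩
    num a * num b * den a                   ≡⟨ cong (_* den a) (sym (num-+ {u} {a} {b} ‖u‖≡)) ⟩
    num u * den a                           ∎
    where
    open ≤-Reasoning
    pow3-1≤ : pow3 1 ≤ 3 ^ suc q
    pow3-1≤ = ^-monoʳ-≤ 3 (subst (_≤ suc q) (sym (+-identityʳ p)) p≤Q)
    24≤3^‖b‖ : 24 ≤ 3 ^ ‖ b ‖
    24≤3^‖b‖ = ≤-trans (m≤m+n 24 3) (≤-trans (^-monoˡ-≤ 3 3≤b) (cube≤3^‖‖ (≤-trans (s≤s z≤n) 3≤b)))
    regroup : ∀ x y z w → x * (y * z) * w ≡ x * z * (y * w)
    regroup = solve-∀
    swap : ∀ x y z → x * y * z ≡ x * z * y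
    swap = solve-∀

  T-bound : ℕ → Set
  T-bound u = (3 * (u ∸ 1) ^ 3) ^ suc q < den u * pow3 1

  -- ¬ T-bound u says 3^(p/Q) ≤ 3(u − 1)³/u³, which is 3^(δ(u) − δ(u − 1)) when ‖u‖ = ‖u − 1‖ + 1.
  drop-one : ∀ {u a} → a + 1 ≡ u → ‖ u ‖ ≡ ‖ a ‖ + 1 → ¬ T-bound u → Drop u a
  drop-one {u} {a} refl ‖u‖≡ ¬bound = begin
    num a * den u * pow3 1            ≡⟨ *-assoc (num a) (den u) (pow3 1) ⟩
    num a * (den u * pow3 1)          ≤⟨ *-monoʳ-≤ (num a) (≮⇒≥ ¬bound) ⟩
    num a * (3 * (a + 1 ∸ 1) ^ 3) ^ suc q ≡⟨ cong (λ x → num a * (3 * x ^ 3) ^ suc q) (m+n∸n≡m a 1) ⟩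
    num a * (3 * a ^ 3) ^ suc q       ≡⟨ cong (num a *_) (^-distribʳ-* 3 (a ^ 3) (suc q)) ⟩
    num a * (3 ^ suc q * den a)       ≡⟨ sym (*-assoc (num a) (3 ^ suc q) (den a)) ⟩
    num a * 3 ^ suc q * den a         ≡⟨ cong (_* den a) (sym (num-+ {a + 1} {a} {1} ‖u‖≡)) ⟩
    num (a + 1) * den a               ∎
    where open ≤-Reasoning

  sum-bound : ∀ {m u a b} → a + b ≡ u → ‖ u ‖ ≡ ‖ a ‖ + ‖ b ‖ → b ≤ a → δ< m u →
    (3 ^ (‖ a ‖ + ‖ b ‖)) ^ suc q < (8 * a ^ 3) ^ suc q * pow3 m
  sum-bound {m} a+b≡u ‖u‖≡ b≤a (δ<-intro δ<u) rewrite sym ‖u‖≡ =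
    <-≤-trans δ<u (*-monoˡ-≤ (pow3 m) (den-sum≤ a+b≡u b≤a))

  data Sweep (k n : ℕ) : Set where
    heavy     : ∀ {f h} → GoodPair n f h → Irreducible f → ¬ δ< 1 f → Sweep k n
    exhausted : ∀ {g y} → GoodPair n g y → δ< k g → δ< 1 y → Sweep k n
    overflow  : ∀ {g y w} → GoodFact n (g ∷ y ∷ w ∷ []) → δ< k g → δ< 1 y → ¬ δ< k (g * y) → Sweep k n

  sweep : ∀ {k n} g y ys → GoodFact n (g ∷ y ∷ ys) → All Irreducible (y ∷ ys) → δ< k g → Sweep k n
  sweep g y ys good (irr ∷ _) δ<g with δ<? 1 y
  ... | no ¬δ<y = heavy (GoodFact-head (GoodFact-swap good)) irr ¬δ<y
  sweep g y [] good _ δ<g | yes δ<y = exhausted (GoodFact⇒GoodPair good) δ<g δ<y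
  sweep {k} g y (z ∷ zs) good (_ ∷ irrs) δ<g | yes δ<y with δ<? k (g * y)
  ... | yes δ<gy = sweep (g * y) z zs (proj₁ (GoodFact-merge good)) irrs δ<gy
  ... | no ¬δ<gy = overflow (GoodFact-collapse₃ good) δ<g δ<y ¬δ<gy

  sweep-factorization : ∀ {k n} → 1 ≤ k → Factorization₂ n → Sweep k n
  sweep-factorization 1≤k (x , y , ys , good , irr ∷ irrs) with δ<? 1 x
  ... | yes δ<x = sweep x y ys good irrs (δ<-mono 1≤k δ<x)
  ... | no ¬δ<x = heavy (GoodFact-head good) irr ¬δ<x

-- The five forms

≤-of-+≡ : ∀ {i j k} → i + j ≡ k + 2 → 2 ≤ j → i ≤ k
≤-of-+≡ {i} {j} {k} i+j≡ 2≤j = +-cancelʳ-≤ 2 i k (subst (i + 2 ≤_) i+j≡ (+-monoʳ-≤ i 2≤j))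

1<p/q : ∀ {p q} → suc q < p → 1ℚ <ℚ (ℤ.+ p) /ℚ suc q
1<p/q {p} {q} q<p = toℚᵘ-cancel-< (ℚᵘ.<-respʳ-≃ (ℚᵘ.≃-sym (toℚᵘ-fromℚᵘ (mkℚᵘ (ℤ.+ p) q)))
  (*<* (subst₂ ℤ._<_ (sym (ℤ.*-identityˡ _)) (sym (ℤ.*-identityʳ _)) (ℤ.+<+ q<p))))

-- This is where α < 1 enters: drop-solid needs 3^(p/(q+1)) ≤ 3.
numerator-bound : (α : ℝ) → U α 1ℚ → ∀ {p q} → L α ((ℤ.+ p) /ℚ suc q) → p ≤ suc q
numerator-bound α α<1 {p} {q} s<α with p ≤? suc q
... | yes p≤q = p≤q
... | no p≰q = ⊥-elim (disjoint α (L-lower α (1<p/q (≰⇒> p≰q)) s<α) α<1)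

module Forms (α : ℝ) (p q : ℕ) (s<α : L α ((ℤ.+ p) /ℚ suc q)) (p≤Q : p ≤ suc q) where
  open Defect p q

  Result : ℕ → ℕ → Set
  Result k n = Form1 α k n ⊎ Form2 α k n ⊎ Form3 α k n ⊎ InT α n ⊎ Form5 α n

  InA-intro : ∀ {m x} → 1 ≤ x → δ< m x → InA α m x
  InA-intro 1≤x δ<x = 1≤x , p , q , s<α , δ<.bound δ<x

  InB-factorʳ : ∀ {m n u v} → Leader n → GoodPair n u v → δ< m v → InB α m v
  InB-factorʳ leader good δ<v = InA-intro (GoodPair.pos₂ good) δ<v , Leader-factorʳ leader good

  InB-factorˡ : ∀ {m n u v} → Leader n → GoodPair n u v → δ< m u → InB α m u
  InB-factorˡ leader good = InB-factorʳ leader (GoodPair-sym good)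

  DroppingSplit : ℕ → Set
  DroppingSplit u = ∃[ a ] ∃[ b ] (1 ≤ b × a + b ≡ u × ‖ u ‖ ≡ ‖ a ‖ + ‖ b ‖ × b ≤ a × Solid b × Drop u a)

  irreducible-cases : ∀ {u} → Irreducible u → InT α u ⊎ DroppingSplit u
  irreducible-cases {u} irr with LargeSolidSummand? u
  ... | yes (b , solid , 1<b , 2b≤u , ‖u‖≡) =
    inj₂ (u ∸ b , b , ≤-trans (s≤s z≤n) 1<b , m∸n+n≡m b≤u , ‖u‖≡ , b≤u-b , solid ,
          drop-solid p≤Q (m∸n+n≡m b≤u) ‖u‖≡ b≤u-b (Solid⇒3≤ solid 1<b))
    where
    b≤u : b ≤ u
    b≤u = ≤-trans (m≤m+n b (b + 0)) 2b≤u
    b≤u-b : b ≤ u ∸ b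
    b≤u-b = m+n≤o⇒m≤o∸n b (subst (_≤ u) (cong (b +_) (+-identityʳ b)) 2b≤u)
  ... | no ¬bad with ¬LargeSolidSummand⇒+1 irr ¬bad
  ... | a , a+1≡u , ‖u‖≡ with (3 * (u ∸ 1) ^ 3) ^ suc q <? den u * pow3 1
  ... | yes bound = inj₁ (inj₂ (proj₁ irr , ¬Reducible⇒MultIrred (proj₂ irr) , (p , q , s<α , bound) , ¬bad))
  ... | no ¬bound = inj₂ (a , 1 , s≤s z≤n , a+1≡u , ‖u‖≡ , 1≤a , Solid-1 , drop-one a+1≡u ‖u‖≡ ¬bound)
    where
    1≤a : 1 ≤ a
    1≤a = ≤-pred (subst (2 ≤_) (trans (sym a+1≡u) (+-comm a 1)) (proj₁ irr))

  dropping-bounds : ∀ {k u a b} → δ< (suc k) u → 1 ≤ b → a + b ≡ u → ‖ u ‖ ≡ ‖ a ‖ + ‖ b ‖ → b ≤ a →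
    Drop u a → InA α k a × SumBound α (suc k) a b
  dropping-bounds δ<u 1≤b a+b≡u ‖u‖≡ b≤a drop =
    InA-intro 1≤a (δ<-drop drop 1≤a δ<u) , p , q , s<α , sum-bound a+b≡u ‖u‖≡ b≤a δ<u
    where
    1≤a = ≤-trans 1≤b b≤a

  DroppingSplit⇒Form2 : ∀ {k n} → δ< (suc k) n → DroppingSplit n → Form2 α k n
  DroppingSplit⇒Form2 δ<n (a , b , 1≤b , a+b≡n , ‖n‖≡ , b≤a , solid , drop) =
    let inA , bound = dropping-bounds δ<n 1≤b a+b≡n ‖n‖≡ b≤a drop in
    a , b , 1≤b , a+b≡n , ‖n‖≡ , inA , b≤a , solid , bound

  irreducible-factor : ∀ {k n f h} → Leader n → GoodPair n f h → Irreducible f → δ< (suc k) n → δ< 1 h →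
    Result k n
  irreducible-factor leader good irr δ<n δ<h with irreducible-cases irr
  ... | inj₁ f∈T =
    inj₂ (inj₂ (inj₂ (inj₂ (_ , _ , GoodPair⇒GoodFact good , f∈T , InB-factorʳ leader good δ<h))))
  ... | inj₂ (a , b , 1≤b , refl , ‖f‖≡ , b≤a , solid , drop) =
    let inA , bound = dropping-bounds (δ<-factorˡ good δ<n) 1≤b refl ‖f‖≡ b≤a drop in
    inj₂ (inj₂ (inj₁ (a , b , _ , 1≤b , GoodPair⇒GoodFact good , InB-factorʳ leader good δ<h , ‖f‖≡ ,
                      inA , b≤a , solid , bound)))

  Form1-pair : ∀ {d n g h} → Leader n → GoodPair n g h → δ< (3 + d) n → δ< (2 + d) g → δ< (2 + d) h →
    Form1 α (2 + d) n
  Form1-pair {d} {n} {g} {h} leader good δ<n δ<g δ<h = descend d 2 refl ≤-refl δ<g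
    where
    k = 2 + d
    levels : ∀ i j → i + j ≡ k + 2 → 2 ≤ i → 2 ≤ j → δ< i g → δ< j h → Form1 α k n
    levels i j i+j≡ 2≤i 2≤j δ<ᵢg δ<ⱼh = inj₂ (s≤s (s≤s z≤n) , i , j , g , h , i+j≡ ,
      2≤i , ≤-of-+≡ i+j≡ 2≤j , 2≤j , ≤-of-+≡ (trans (+-comm j i) i+j≡) 2≤i , GoodPair⇒GoodFact good ,
      InB-factorˡ leader good δ<ᵢg , InB-factorʳ leader good δ<ⱼh)
    -- The least level i = 2 + e ≥ 2 with δ(g) < i·p/Q leaves δ(h) < (k + 2 − i)·p/Q.
    descend : ∀ e j → 2 + e + j ≡ k + 2 → 2 ≤ j → δ< (2 + e) g → Form1 α k n
    descend zero j 2+j≡ 2≤j δ<₂g =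
      levels 2 j 2+j≡ ≤-refl 2≤j δ<₂g (subst (λ m → δ< m h) k≡j δ<h)
      where
      k≡j : k ≡ j
      k≡j = sym (suc-injective (suc-injective (trans 2+j≡ (+-comm k 2))))
    descend (suc e) j 3+e+j≡ 2≤j δ<g′ with δ<? (2 + e) g
    ... | yes δ<g″ = descend e (suc j) (trans (+-suc (2 + e) j) 3+e+j≡) (≤-trans 2≤j (n≤1+n j)) δ<g″
    ... | no ¬δ<g″ = levels (3 + e) j 3+e+j≡ (s≤s (s≤s z≤n)) 2≤j δ<g′
      (δ<-cancel good (subst (λ m → δ< m n) (sym (suc-injective (trans 3+e+j≡ (+-comm k 2)))) δ<n) ¬δ<g″)

  conclude-1 : ∀ {n} → Leader n → δ< 2 n → Sweep 1 n → Result 1 n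
  conclude-1 leader δ<n (heavy good irr ¬δ<f) = irreducible-factor leader good irr δ<n (δ<-cancel good δ<n ¬δ<f)
  conclude-1 leader δ<n (exhausted good δ<g δ<y) =
    inj₁ (inj₁ (refl , inj₁ (_ , _ , GoodPair⇒GoodFact good ,
                             InB-factorˡ leader good δ<g , InB-factorʳ leader good δ<y)))
  conclude-1 leader δ<n (overflow triple δ<g δ<y ¬δ<gy) =
    inj₁ (inj₁ (refl , inj₂ (_ , _ , _ , triple , InB-factorˡ leader g∣n δ<g , InB-factorˡ leader y∣n δ<y ,
                             InB-factorʳ leader gy∣n (δ<-cancel gy∣n δ<n ¬δ<gy))))
    where
    g∣n = GoodFact-head triple
    y∣n = GoodFact-head (GoodFact-swap triple)
    gy∣n = GoodFact⇒GoodPair (proj₁ (GoodFact-merge triple))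

  conclude-2+ : ∀ {d n} → Leader n → δ< (3 + d) n → Sweep (2 + d) n → Result (2 + d) n
  conclude-2+ leader δ<n (heavy {h = h} good irr ¬δ<f) with δ<? 1 h
  ... | yes δ<h = irreducible-factor leader good irr δ<n δ<h
  ... | no ¬δ<h =
    inj₁ (Form1-pair leader good δ<n (δ<-cancel (GoodPair-sym good) δ<n ¬δ<h) (δ<-cancel good δ<n ¬δ<f))
  conclude-2+ leader δ<n (exhausted good δ<g δ<y) =
    inj₁ (Form1-pair leader good δ<n δ<g (δ<-mono (s≤s z≤n) δ<y))
  conclude-2+ leader δ<n (overflow {g} triple δ<g δ<y ¬δ<gy) =
    inj₁ (Form1-pair leader g∣n δ<n δ<g (δ<-cancel g∣n δ<n ¬δ<₁g))
    where
    g∣n = GoodFact-head triple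
    ¬δ<₁g : ¬ δ< 1 g
    ¬δ<₁g δ<₁g = ¬δ<gy (δ<-mono (s≤s (s≤s z≤n)) (δ<-* (proj₂ (GoodFact-merge triple)) δ<₁g δ<y))

  leader-forms : ∀ k → 1 ≤ k → ∀ n → 1 ≤ n → δ< (suc k) n → Leader n → Result k n
  leader-forms k 1≤k 1 _ _ _ = inj₂ (inj₂ (inj₂ (inj₁ (inj₁ refl))))
  leader-forms k 1≤k n@(suc (suc _)) _ δ<n leader with Reducible? n
  ... | no irreducible =
    [ (λ n∈T → inj₂ (inj₂ (inj₂ (inj₁ n∈T)))) , (λ split → inj₂ (inj₁ (DroppingSplit⇒Form2 δ<n split))) ]′
      (irreducible-cases (s≤s (s≤s z≤n) , irreducible))
  ... | yes reducible with sweep-factorization 1≤k (reducible-factorization reducible)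
  leader-forms (suc zero) _ n _ δ<n leader | yes _ | swept = conclude-1 leader δ<n swept
  leader-forms (suc (suc d)) _ n _ δ<n leader | yes _ | swept = conclude-2+ leader δ<n swept

theorem4p4 : (α : ℝ) → L α 0ℚ → U α 1ℚ → (k : ℕ) → 1 ≤ k →
    (n : ℕ) → InB α (suc k) n →
    Form1 α k n ⊎ Form2 α k n ⊎ Form3 α k n ⊎ InT α n ⊎ Form5 α n
theorem4p4 α _ α<1 k 1≤k n ((1≤n , p , q , s<α , bound) , leader) =
  Forms.leader-forms α p q s<α (numerator-bound α α<1 s<α) k 1≤k n 1≤n (Defect.δ<-intro bound) leader
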